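{- Let $(G,k)$ be an instance of Paw-free Edge Deletion, and let $M$ be the set of all vertices of the paws in a maximal family of pairwise edge-disjoint induced paws of $G$. Let $C$ be a connected component of $G-M$ that is a complete multipartite graph, and call a part $P$ of $C$ full if every vertex of $N(C)$ is adjacent to every vertex of $P$. Let $G^*$ be obtained from $G$ by deleting the vertices of all but $k+4$ of the full parts of $C$ (if $C$ has at most $k+4$ full parts, nothing is deleted). Then $(G,k)$ is a yes-instance if and only if $(G^*,k)$ is a yes-instance.
   Context: All graphs are finite, simple and undirected. A paw is the four-vertex graph consisting of a triangle together with one additional vertex adjacent to exactly one vertex of the triangle; a graph is paw-free if it has no induced paw. Paw-free Edge Deletion: given a graph $G$ and an integer $k\ge 0$, decide whether there is $E_-\subseteq E(G)$ with $|E_-|\le k$ such that $G-E_-$ is paw-free. A family of induced paws is pairwise edge-disjoint if no edge of $G$ belongs to two of them; it is maximal if no further induced paw of $G$ can be added. A complete multipartite graph is a graph whose vertex set can be partitioned into $p\ge 3$ independent sets (parts) with every pair of vertices from different parts adjacent. $N(C)$ is the set of vertices outside $V(C)$ adjacent to some vertex of $C$. -}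

module Defs where

open import Data.Nat using (ℕ; zero; suc; _+_; _≤_)
open import Data.Fin using (Fin)
open import Data.Bool using (Bool; true; false; if_then_else_)
open import Data.List using (List; []; _∷_; length; lookup)
open import Data.List.Relation.Unary.All using (All)
open import Data.List.Membership.Propositional using (_∈_)
open import Data.Product using (Σ; ∃; ∃-syntax; _×_; _,_; proj₁; proj₂)
open import Data.Sum using (_⊎_)
open import Relation.Nullary using (¬_)
open import Relation.Binary.PropositionalEquality using (_≡_; _≢_)
open import Function.Bundles using (_⇔_)

record Graph (n : ℕ) : Set₁ where
  field
    E      : Fin n → Fin n → Set
    sym    : ∀ {u v} → E u v → E v u
    irrefl : ∀ {u} → ¬ E u u
open Graph public

-- Induced paws: triangle a b c, plus d adjacent to c only.
-- (Distinctness of a,b,c,d is forced by irreflexivity.)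

IsPawR : ∀ {n} → (Fin n → Fin n → Set) → Fin n → Fin n → Fin n → Fin n → Set
IsPawR R a b c d = R a b × R a c × R b c × R c d × ¬ R d a × ¬ R d b

PawFreeR : ∀ {n} → (Fin n → Fin n → Set) → Set
PawFreeR R = ∀ a b c d → ¬ IsPawR R a b c d

IsPaw : ∀ {n} → Graph n → Fin n → Fin n → Fin n → Fin n → Set
IsPaw G = IsPawR (E G)

-- Paw-free Edge Deletion.  E₋ is given as a list of (ordered
-- representatives of) edges of G; |E₋| ≤ k is witnessed by the list
-- length (duplicates only increase the length).

EdgeList : ℕ → Set
EdgeList n = List (Fin n × Fin n)

DelE : ∀ {n} → Graph n → EdgeList n → Fin n → Fin n → Set
DelE G L u v = E G u v × ¬ ((u , v) ∈ L) × ¬ ((v , u) ∈ L)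

YesInstance : ∀ {n} → Graph n → ℕ → Set
YesInstance {n} G k =
  Σ (EdgeList n) λ L →
    length L ≤ k × All (λ e → E G (proj₁ e) (proj₂ e)) L × PawFreeR (DelE G L)

record Quad (n : ℕ) : Set where
  constructor quad
  field a b c d : Fin n
open Quad public

pawEdges : ∀ {n} → Quad n → EdgeList n
pawEdges q = (a q , b q) ∷ (a q , c q) ∷ (b q , c q) ∷ (c q , d q) ∷ []

SameEdge : ∀ {n} → Fin n × Fin n → Fin n × Fin n → Set
SameEdge (u , v) (x , y) = ((u ≡ x) × (v ≡ y)) ⊎ ((u ≡ y) × (v ≡ x))

ShareEdge : ∀ {n} → Quad n → Quad n → Set
ShareEdge p q = ∃[ e ] ∃[ f ] (e ∈ pawEdges p × f ∈ pawEdges q × SameEdge e f)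

IsPawQ : ∀ {n} → Graph n → Quad n → Set
IsPawQ G q = IsPaw G (a q) (b q) (c q) (d q)

record MaximalEdgeDisjointPawFamily {n} (G : Graph n) (F : List (Quad n)) : Set where
  field
    allPaws  : All (IsPawQ G) F
    disjoint : ∀ (i j : Fin (length F)) → i ≢ j →
               ¬ ShareEdge (lookup F i) (lookup F j)
    maximal  : ∀ (q : Quad n) → IsPawQ G q →
               ∃[ i ] ShareEdge q (lookup F i)

VertexOfQuad : ∀ {n} → Fin n → Quad n → Set
VertexOfQuad v q = (v ≡ a q) ⊎ (v ≡ b q) ⊎ (v ≡ c q) ⊎ (v ≡ d q)

PawVertices : ∀ {n} → List (Quad n) → Fin n → Set
PawVertices F v = ∃[ i ] VertexOfQuad v (lookup F i)

data PathIn {n} (G : Graph n) (P : Fin n → Set) : Fin n → Fin n → Set where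
  here : ∀ {u} → P u → PathIn G P u u
  step : ∀ {u w v} → P u → E G u w → PathIn G P w v → PathIn G P u v

record IsComponent {n} (G : Graph n) (M : Fin n → Set) (C : Fin n → Set) : Set where
  field
    outsideM  : ∀ v → C v → ¬ M v
    nonempty  : ∃[ v ] C v
    connected : ∀ u v → C u → C v → PathIn G (λ x → ¬ M x) u v
    closed    : ∀ u v → C u → ¬ M v → E G u v → C v

-- C induces a complete multipartite graph with the p ≥ 3 parts
-- P_i = { v ∈ C | part v ≡ i }, i : Fin p
record CompleteMultipartition {n} (G : Graph n) (C : Fin n → Set)
         (p : ℕ) (part : Fin n → Fin p) : Set where
  field
    atLeast3  : 3 ≤ p
    nonemptyP : ∀ (i : Fin p) → ∃[ v ] (C v × part v ≡ i)
    adjacency : ∀ u v → C u → C v → (E G u v ⇔ (part u ≢ part v))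

Nbhd : ∀ {n} → Graph n → (Fin n → Set) → Fin n → Set
Nbhd G C u = ¬ C u × ∃[ v ] (C v × E G u v)

FullPart : ∀ {n} → Graph n → (Fin n → Set) → ∀ {p} → (Fin n → Fin p) → Fin p → Set
FullPart G C part i = ∀ u v → Nbhd G C u → C v → part v ≡ i → E G u v

countTrue : ∀ {p} → (Fin p → Bool) → ℕ
countTrue {zero}  f = 0
countTrue {suc p} f = (if f Fin.zero then 1 else 0) + countTrue (λ i → f (Fin.suc i))

record KeptFullParts {n} (G : Graph n) (C : Fin n → Set) {p} (part : Fin n → Fin p)
         (k : ℕ) (K : Fin p → Bool) : Set where
  field
    keptFull  : ∀ i → K i ≡ true → FullPart G C part i
    atMost    : countTrue K ≤ k + 4
    allOrK+4  : (∀ i → FullPart G C part i → K i ≡ true) ⊎ (countTrue K ≡ k + 4)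

Deleted : ∀ {n} → Graph n → (Fin n → Set) → ∀ {p} → (Fin n → Fin p) →
          (Fin p → Bool) → Fin n → Set
Deleted G C part K v = C v × FullPart G C part (part v) × K (part v) ≡ false

record InducedSubgraphOn {n m} (G : Graph n) (S : Fin n → Set)
         (H : Graph m) (ι : Fin m → Fin n) : Set where
  field
    injective : ∀ x y → ι x ≡ ι y → x ≡ y
    image     : ∀ v → S v ⇔ (∃[ x ] ι x ≡ v)
    adj       : ∀ x y → E H x y ⇔ E G (ι x) (ι y)

-- Two vertices of C lying in full parts have the same neighbours outside
-- their own parts: inside C adjacency only depends on the parts, and every
-- neighbour of C outside C sees all of both.  So restricting a solution of
-- G to G* solves G*, and conversely a solution L of G* (of size ≤ k) solves
-- G: a paw of G − L through a deleted vertex s can be moved to a vertex q of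
-- a kept full part, provided part q contains none of the other three paw
-- vertices and no edge of L joins q to them.  Each of these constraints rules
-- out at most one part, at most k + 3 in total, and k + 4 full parts are kept
-- whenever any vertex is deleted.  Repeating this for the four vertices of
-- the paw yields a paw of G* − L.
module Submission where

open import Defs
open import Data.Nat using (ℕ; zero; suc; _+_; _≤_; _<_; z≤n; s≤s)
open import Data.Nat.Properties
  using (≤-trans; ≤-refl; ≤-reflexive; m≤n⇒m≤1+n; +-comm; +-mono-≤; <⇒≱; module ≤-Reasoning)
open import Data.Fin using (Fin; zero; suc; _≟_)
open import Data.Fin.Properties using (any?; ¬∀⟶∃¬)
open import Data.Bool using (Bool; true; false; if_then_else_)
import Data.Bool as Bool
open import Data.Maybe using (Maybe; just; nothing)
open import Data.List using (List; []; _∷_; length; map; _++_; mapMaybe)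
open import Data.List.Properties using (length-map; length-++; length-mapMaybe)
open import Data.List.Relation.Unary.All using (tabulate)
import Data.List.Relation.Unary.All as All
open import Data.List.Relation.Unary.Any using (here; there)
open import Data.List.Membership.Propositional using (_∈_; _∉_)
open import Data.List.Membership.Propositional.Properties
  using (∈-map⁺; ∈-map⁻; ∈-++⁺ˡ; ∈-++⁺ʳ)
import Data.List.Membership.DecPropositional as DecMembership
open import Data.Product using (∃; ∃-syntax; _×_; _,_; proj₁; proj₂)
import Data.Product as Product
open import Data.Sum using (inj₁; inj₂)
open import Data.Empty using (⊥-elim)
open import Effect.Monad using (RawMonad)
open import Level using (0ℓ)
open import Relation.Nullary using (¬_; Dec; yes; no; does)
open import Relation.Nullary.Decidable
  using (dec-true; dec-false; _→-dec_; decidable-stable; ¬¬-excluded-middle)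
open import Relation.Nullary.Negation using (¬¬-Monad; contradiction)
open import Relation.Binary.PropositionalEquality
  using (_≡_; _≢_; refl; cong; subst; trans) renaming (sym to ≡-sym)
open import Function using (_∘_)
open import Function.Bundles using (_⇔_; mk⇔; Equivalence)

-- Membership in C and deletedness are not decidable, so case analyses on
-- them run in the double-negation monad; paw-freeness is a negation anyway.
open RawMonad (¬¬-Monad {0ℓ}) using (_>>=_; pure)

open Equivalence using (to; from)

∈-mapMaybe⁺ : ∀ {A B : Set} (f : A → Maybe B) {xs a b} →
              a ∈ xs → f a ≡ just b → b ∈ mapMaybe f xs
∈-mapMaybe⁺ f {x ∷ xs} (here refl) fa≡b rewrite fa≡b = here refl
∈-mapMaybe⁺ f {x ∷ xs} (there a∈xs) fa≡b with f x
... | nothing = ∈-mapMaybe⁺ f a∈xs fa≡b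
... | just _  = there (∈-mapMaybe⁺ f a∈xs fa≡b)

∈-mapMaybe⁻ : ∀ {A B : Set} (f : A → Maybe B) {xs b} →
              b ∈ mapMaybe f xs → ∃ λ a → a ∈ xs × f a ≡ just b
∈-mapMaybe⁻ f {x ∷ xs} b∈ with f x in fx≡
∈-mapMaybe⁻ f {x ∷ xs} b∈          | nothing = Product.map₂ (Product.map₁ there) (∈-mapMaybe⁻ f b∈)
∈-mapMaybe⁻ f {x ∷ xs} (here refl)  | just _  = x , here refl , fx≡
∈-mapMaybe⁻ f {x ∷ xs} (there b∈)   | just _  = Product.map₂ (Product.map₁ there) (∈-mapMaybe⁻ f b∈)

dropZero : ∀ {p} → List (Fin (suc p)) → List (Fin p)
dropZero []           = []
dropZero (zero  ∷ is) = dropZero is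
dropZero (suc i ∷ is) = i ∷ dropZero is

length-dropZero : ∀ {p} (is : List (Fin (suc p))) → length (dropZero is) ≤ length is
length-dropZero []           = z≤n
length-dropZero (zero  ∷ is) = m≤n⇒m≤1+n (length-dropZero is)
length-dropZero (suc i ∷ is) = s≤s (length-dropZero is)

length-dropZero-< : ∀ {p} (is : List (Fin (suc p))) → zero ∈ is →
                    length (dropZero is) < length is
length-dropZero-< (zero  ∷ is) _            = s≤s (length-dropZero is)
length-dropZero-< (suc i ∷ is) (there 0∈is) = s≤s (length-dropZero-< is 0∈is)

∈-dropZero : ∀ {p} (is : List (Fin (suc p))) {i} → suc i ∈ is → i ∈ dropZero is
∈-dropZero (zero  ∷ is) (there i∈is) = ∈-dropZero is i∈is
∈-dropZero (suc i ∷ is) (here refl)  = here refl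
∈-dropZero (suc j ∷ is) (there i∈is) = there (∈-dropZero is i∈is)

countTrue≤length : ∀ {p} (K : Fin p → Bool) (is : List (Fin p)) →
                   (∀ i → K i ≡ true → i ∈ is) → countTrue K ≤ length is
countTrue≤length {zero}  K is _ = z≤n
countTrue≤length {suc p} K is K⊆is
  with K zero in K0 | countTrue≤length (K ∘ suc) (dropZero is) (λ i → ∈-dropZero is ∘ K⊆is (suc i))
... | true  | rest = ≤-trans (s≤s rest) (length-dropZero-< is (K⊆is zero K0))
... | false | rest = ≤-trans rest (length-dropZero is)

∃-true-∉ : ∀ {p} (K : Fin p → Bool) (is : List (Fin p)) →
           length is < countTrue K → ∃ λ i → K i ≡ true × i ∉ is
∃-true-∉ {p} K is |is|<count = i , Ki , i∉is
  where
  open DecMembership (_≟_ {p}) using (_∈?_)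

  counterexample : ∃ λ i → ¬ (K i ≡ true → i ∈ is)
  counterexample = ¬∀⟶∃¬ p _ (λ i → (K i Bool.≟ true) →-dec (i ∈? is))
                             (<⇒≱ |is|<count ∘ countTrue≤length K is)

  i : Fin p
  i = proj₁ counterexample

  Ki : K i ≡ true
  Ki = decidable-stable (K i Bool.≟ true)
         (λ ¬Ki → proj₂ counterexample (λ Ki → contradiction Ki ¬Ki))

  i∉is : i ∉ is
  i∉is i∈is = proj₂ counterexample (λ _ → i∈is)

IsPawR-embedding : ∀ {n m} {R : Fin n → Fin n → Set} {S : Fin m → Fin m → Set}
                   (ι : Fin m → Fin n) → (∀ x y → S x y ⇔ R (ι x) (ι y)) →
                   ∀ {a b c d} → IsPawR S a b c d ⇔ IsPawR R (ι a) (ι b) (ι c) (ι d)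
IsPawR-embedding ι S⇔R = mk⇔
  (λ (ab , ac , bc , cd , ¬da , ¬db) →
     to (S⇔R _ _) ab , to (S⇔R _ _) ac , to (S⇔R _ _) bc , to (S⇔R _ _) cd ,
     ¬da ∘ from (S⇔R _ _) , ¬db ∘ from (S⇔R _ _))
  (λ (ab , ac , bc , cd , ¬da , ¬db) →
     from (S⇔R _ _) ab , from (S⇔R _ _) ac , from (S⇔R _ _) bc , from (S⇔R _ _) cd ,
     ¬da ∘ to (S⇔R _ _) , ¬db ∘ to (S⇔R _ _))

DelE-sym : ∀ {n} (G : Graph n) (L : EdgeList n) {u v} → DelE G L u v → DelE G L v u
DelE-sym G L (uv , uv∉L , vu∉L) = sym G uv , vu∉L , uv∉L

module Embedding {n m} (G : Graph n) (H : Graph m) (ι : Fin m → Fin n)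
  (ι-injective : ∀ x y → ι x ≡ ι y → x ≡ y)
  (ι-adj : ∀ x y → E H x y ⇔ E G (ι x) (ι y)) where

  DelE-embedding : (L : EdgeList n) (L′ : EdgeList m) →
                   (∀ {x y} → (x , y) ∈ L′ ⇔ (ι x , ι y) ∈ L) →
                   ∀ x y → DelE H L′ x y ⇔ DelE G L (ι x) (ι y)
  DelE-embedding L L′ ∈L′⇔ x y = mk⇔
    (λ (xy , xy∉ , yx∉) → to (ι-adj x y) xy , xy∉ ∘ from ∈L′⇔ , yx∉ ∘ from ∈L′⇔)
    (λ (xy , xy∉ , yx∉) → from (ι-adj x y) xy , xy∉ ∘ to ∈L′⇔ , yx∉ ∘ to ∈L′⇔)

  push : EdgeList m → EdgeList n
  push = map (Product.map ι ι)

  ∈-push : ∀ {L′ x y} → (x , y) ∈ L′ ⇔ (ι x , ι y) ∈ push L′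
  ∈-push {L′} = mk⇔ (∈-map⁺ (Product.map ι ι)) ∈-push⁻
    where
    ∈-push⁻ : ∀ {x y} → (ι x , ι y) ∈ push L′ → (x , y) ∈ L′
    ∈-push⁻ ιxy∈ with ∈-map⁻ (Product.map ι ι) ιxy∈
    ... | (x′ , y′) , xy′∈ , eq
      rewrite ι-injective _ _ (cong proj₁ eq) | ι-injective _ _ (cong proj₂ eq) = xy′∈

  preimage? : ∀ u → Dec (∃ λ x → ι x ≡ u)
  preimage? u = any? λ x → ι x ≟ u

  pullback : Fin n × Fin n → Maybe (Fin m × Fin m)
  pullback (u , v) with preimage? u | preimage? v
  ... | yes (x , _) | yes (y , _) = just (x , y)
  ... | _           | _           = nothing

  pullback-sound : ∀ {u v x y} → pullback (u , v) ≡ just (x , y) → ι x ≡ u × ι y ≡ v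
  pullback-sound {u} {v} eq with preimage? u | preimage? v
  pullback-sound refl | yes (_ , ιx≡u) | yes (_ , ιy≡v) = ιx≡u , ιy≡v
  pullback-sound ()   | yes _          | no _
  pullback-sound ()   | no _           | _

  pullback-ι : ∀ x y → pullback (ι x , ι y) ≡ just (x , y)
  pullback-ι x y with preimage? (ι x) | preimage? (ι y)
  ... | yes (x′ , ιx′≡ιx) | yes (y′ , ιy′≡ιy)
    rewrite ι-injective _ _ ιx′≡ιx | ι-injective _ _ ιy′≡ιy = refl
  ... | yes _ | no ∄y = ⊥-elim (∄y (y , refl))
  ... | no ∄x | _     = ⊥-elim (∄x (x , refl))

  pull : EdgeList n → EdgeList m
  pull = mapMaybe pullback

  ∈-pull : ∀ {L x y} → (x , y) ∈ pull L ⇔ (ι x , ι y) ∈ L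
  ∈-pull {L} {x} {y} = mk⇔ ∈-pull⁻ (λ ιxy∈ → ∈-mapMaybe⁺ pullback ιxy∈ (pullback-ι x y))
    where
    ∈-pull⁻ : (x , y) ∈ pull L → (ι x , ι y) ∈ L
    ∈-pull⁻ xy∈ with ∈-mapMaybe⁻ pullback xy∈
    ... | (u , v) , uv∈ , eq with pullback-sound eq
    ...   | refl , refl = uv∈

  YesInstance-restrict : ∀ {k} → YesInstance G k → YesInstance H k
  YesInstance-restrict (L , |L|≤k , L⊆E , pawFree) =
    pull L ,
    ≤-trans (length-mapMaybe pullback L) |L|≤k ,
    tabulate (λ xy∈ → from (ι-adj _ _) (All.lookup L⊆E (to ∈-pull xy∈))) ,
    λ a b c d → pawFree (ι a) (ι b) (ι c) (ι d)
              ∘ to (IsPawR-embedding {R = DelE G L} ι (DelE-embedding L (pull L) ∈-pull))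

module FullParts {n} (G : Graph n) (k : ℕ) (C : Fin n → Set)
  {p} (part : Fin n → Fin p) (cm : CompleteMultipartition G C p part)
  (K : Fin p → Bool) (kept : KeptFullParts G C part k K) where

  open CompleteMultipartition cm
  open KeptFullParts kept

  Full : Fin p → Set
  Full = FullPart G C part

  Del : Fin n → Set
  Del = Deleted G C part K

  Undeleted : Fin n → Set
  Undeleted v = ¬ Del v

  Full-dominates : ∀ {x x′ y} → C x → C x′ → Full (part x′) →
                   (C y → part y ≢ part x′) → E G x y → ¬ ¬ E G x′ y
  Full-dominates {x} {x′} {y} Cx Cx′ full different xy = do
    yes Cy ← ¬¬-excluded-middle
      where no ¬Cy → pure (sym G (full y x′ (¬Cy , x , Cx , sym G xy) Cx′ refl))
    pure (from (adjacency x′ y Cx′ Cy) (different Cy ∘ ≡-sym))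

  Del-sibling : ∀ {s v} → Del s → C v → part v ≡ part s → Del v
  Del-sibling (_ , full , notKept) Cv v≡s =
    Cv , subst Full (≡-sym v≡s) full , subst (λ i → K i ≡ false) (≡-sym v≡s) notKept

  countTrue-kept : ∀ {s} → Del s → countTrue K ≡ k + 4
  countTrue-kept (_ , full , notKept) with allOrK+4
  ... | inj₂ count = count
  ... | inj₁ allKept with trans (≡-sym (allKept _ full)) notKept
  ...   | ()

  module Solution (L : EdgeList n) (|L|≤k : length L ≤ k)
    (L-undeleted : ∀ {u v} → (u , v) ∈ L → Undeleted u × Undeleted v) where

    R : Fin n → Fin n → Set
    R = DelE G L

    R-sym : ∀ {u v} → R u v → R v u
    R-sym = DelE-sym G L

    R-Del : ∀ {s y} → Del s → E G s y → R s y
    R-Del Del-s sy = sy , (λ sy∈ → proj₁ (L-undeleted sy∈) Del-s)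
                        , (λ ys∈ → proj₂ (L-undeleted ys∈) Del-s)

    R-to-Del : ∀ {s x y} → Del s → C x → (C y → part y ≢ part s) → E G x y → ¬ ¬ R s y
    R-to-Del Del-s@(Cs , full , _) Cx different xy = do
      sy ← Full-dominates Cx Cs full different xy
      pure (R-Del Del-s sy)

    R-twin : ∀ {s v z} → Del s → C v → part v ≡ part s → R s z → ¬ ¬ R v z
    R-twin Del-s Cv v≡s (sz , _) =
      R-to-Del (Del-sibling Del-s Cv v≡s) (proj₁ Del-s)
        (λ Cz z≡v → to (adjacency _ _ (proj₁ Del-s) Cz) sz (≡-sym (trans z≡v v≡s))) sz

    Avoids : Fin n → Fin n → Set
    Avoids q y = part y ≢ part q × (q , y) ∉ L × (y , q) ∉ L

    record Substitute (ys : List (Fin n)) : Set where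
      field
        vertex   : Fin n
        inC      : C vertex
        full     : Full (part vertex)
        isKept   : K (part vertex) ≡ true
        avoids   : ∀ {y} → y ∈ ys → Avoids vertex y

      undeleted : Undeleted vertex
      undeleted (_ , _ , notKept) with trans (≡-sym isKept) notKept
      ... | ()

      R-to-Substitute : ∀ {s y} → Del s → y ∈ ys → R s y → ¬ ¬ R vertex y
      R-to-Substitute (Cs , _) y∈ys (sy , _) = do
        let different , qy∉L , yq∉L = avoids y∈ys
        qy ← Full-dominates Cs inC full (λ _ → different) sy
        pure (qy , qy∉L , yq∉L)

    module _ (ys : List (Fin n)) where
      open DecMembership (_≟_ {n}) using (_∈?_)

      -- an edge of L can only join a vertex of ys to the substitute through
      -- its other endpoint, whose part is therefore excluded
      blocked : Fin n × Fin n → Fin p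
      blocked (u , w) = if does (w ∈? ys) then part u else part w

      excluded : List (Fin p)
      excluded = map part ys ++ map blocked L

      length-excluded : length excluded ≡ length ys + length L
      length-excluded rewrite length-++ (map part ys) {map blocked L}
                            | length-map part ys | length-map blocked L = refl

      Avoids-if-∉ : ∀ {q y} → part q ∉ excluded → y ∈ ys → Avoids q y
      Avoids-if-∉ {q} {y} q∉ y∈ys =
          (λ y≡q → q∉ (subst (_∈ excluded) y≡q (∈-++⁺ˡ (∈-map⁺ part y∈ys))))
        , (λ qy∈L → q∉ (blocked-∈ qy∈L (cong (if_then part q else part y) (dec-true (y ∈? ys) y∈ys))))
        , yq∉L
        where
        blocked-∈ : ∀ {e i} → e ∈ L → blocked e ≡ i → i ∈ excluded
        blocked-∈ e∈L refl = ∈-++⁺ʳ (map part ys) (∈-map⁺ blocked e∈L)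

        yq∉L : (y , q) ∉ L
        yq∉L yq∈L with q ∈? ys
        ... | yes q∈ys = q∉ (∈-++⁺ˡ (∈-map⁺ part q∈ys))
        ... | no  q∉ys = q∉ (blocked-∈ yq∈L (cong (if_then part y else part q) (dec-false (q ∈? ys) q∉ys)))

      substitute : ∀ {s} → length ys ≤ 3 → Del s → Substitute ys
      substitute |ys|≤3 Del-s
        with ∃-true-∉ K excluded
               (begin-strict
                  length excluded      ≡⟨ length-excluded ⟩
                  length ys + length L ≤⟨ +-mono-≤ |ys|≤3 |L|≤k ⟩
                  3 + k                <⟨ ≤-reflexive (+-comm 4 k) ⟩
                  k + 4                ≡⟨ countTrue-kept Del-s ⟨
                  countTrue K          ∎)
        where open ≤-Reasoning
      ... | i , Ki , i∉ with nonemptyP i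
      ...   | q , Cq , refl = record
        { vertex = q ; inC = Cq ; full = keptFull _ Ki ; isKept = Ki
        ; avoids = Avoids-if-∉ i∉ }

    Undeletable : (Fin n → Set) → Set
    Undeletable P = ¬ ¬ (∃[ v ] (Undeleted v × P v))

    undelete : ∀ {P : Fin n → Set} {v} → (Del v → P v → Undeletable P) → P v → Undeletable P
    undelete {v = v} replace Pv = do
      yes Del-v ← ¬¬-excluded-middle
        where no ¬Del-v → pure (v , ¬Del-v , Pv)
      replace Del-v Pv

    replace-a : ∀ {a b c d} → Del a → IsPawR R a b c d →
                Undeletable (λ a′ → IsPawR R a′ b c d)
    replace-a {a} {b} {c} {d} Del-a (ab , ac , bc , cd , ¬da , ¬db) = do
        qb ← R-to-Substitute Del-a (here refl) ab
        qc ← R-to-Substitute Del-a (there (here refl)) ac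
        pure (vertex , undeleted , qb , qc , bc , cd , ¬dq , ¬db)
      where
      open Substitute (substitute (b ∷ c ∷ d ∷ []) ≤-refl Del-a)
      ¬dq : ¬ R d vertex
      ¬dq (dq , _) = R-to-Del Del-a inC
        (λ Cd d≡a → R-twin Del-a Cd d≡a ab ¬db) (sym G dq) (¬da ∘ R-sym)

    replace-c : ∀ {a b c d} → Del c → IsPawR R a b c d →
                Undeletable (λ c′ → IsPawR R a b c′ d)
    replace-c {a} {b} {c} {d} Del-c (ab , ac , bc , cd , ¬da , ¬db) = do
        qa ← R-to-Substitute Del-c (here refl) (R-sym ac)
        qb ← R-to-Substitute Del-c (there (here refl)) (R-sym bc)
        qd ← R-to-Substitute Del-c (there (there (here refl))) cd
        pure (vertex , undeleted , ab , R-sym qa , R-sym qb , qd , ¬da , ¬db)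
      where open Substitute (substitute (a ∷ b ∷ d ∷ []) ≤-refl Del-c)

    replace-d : ∀ {a b c d} → Del d → IsPawR R a b c d →
                Undeletable (λ d′ → IsPawR R a b c d′)
    replace-d {a} {b} {c} {d} Del-d (ab , ac , bc , cd , ¬da , ¬db) = do
        qc ← R-to-Substitute Del-d (there (there (here refl))) (R-sym cd)
        pure (vertex , undeleted , ab , ac , bc , R-sym qc , ¬qa , ¬qb)
      where
      open Substitute (substitute (a ∷ b ∷ c ∷ []) ≤-refl Del-d)
      ¬qa : ¬ R vertex a
      ¬qa (qa , _) = R-to-Del Del-d inC
        (λ Ca a≡d → R-twin (Del-sibling Del-d Ca a≡d) (proj₁ Del-d) (≡-sym a≡d) ab ¬db) qa ¬da
      ¬qb : ¬ R vertex b
      ¬qb (qb , _) = R-to-Del Del-d inC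
        (λ Cb b≡d → R-twin (Del-sibling Del-d Cb b≡d) (proj₁ Del-d) (≡-sym b≡d) (R-sym ab) ¬da) qb ¬db

    swap-ab : ∀ {a b c d} → IsPawR R a b c d → IsPawR R b a c d
    swap-ab (ab , ac , bc , cd , ¬da , ¬db) = R-sym ab , bc , ac , cd , ¬db , ¬da

    PawFree-if-undeleted : (∀ a b c d → Undeleted a → Undeleted b → Undeleted c →
                            Undeleted d → ¬ IsPawR R a b c d) → PawFreeR R
    PawFree-if-undeleted noPaw a b c d paw =
      undelete replace-a paw           λ (a′ , ¬Del-a′ , paw₁) →
      undelete replace-a (swap-ab paw₁) λ (b′ , ¬Del-b′ , paw₂) →
      undelete replace-c (swap-ab paw₂) λ (c′ , ¬Del-c′ , paw₃) →
      undelete replace-d paw₃           λ (d′ , ¬Del-d′ , paw₄) →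
      noPaw a′ b′ c′ d′ ¬Del-a′ ¬Del-b′ ¬Del-c′ ¬Del-d′ paw₄

  YesInstance-extend : ∀ {m} (H : Graph m) (ι : Fin m → Fin n) →
                       InducedSubgraphOn G Undeleted H ι → YesInstance H k → YesInstance G k
  YesInstance-extend H ι ind (L′ , |L′|≤k , L′⊆E , pawFree) =
    push L′ , |push|≤k , tabulate push-⊆E ,
    Solution.PawFree-if-undeleted (push L′) |push|≤k push-undeleted noUndeletedPaw
    where
    open InducedSubgraphOn ind
    open Embedding G H ι injective adj

    |push|≤k : length (push L′) ≤ k
    |push|≤k = subst (_≤ k) (≡-sym (length-map _ L′)) |L′|≤k

    ι-undeleted : ∀ x → Undeleted (ι x)
    ι-undeleted x = from (image (ι x)) (x , refl)

    push-image : ∀ {e} → e ∈ push L′ → ∃ λ xy → xy ∈ L′ × e ≡ Product.map ι ι xy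
    push-image = ∈-map⁻ (Product.map ι ι)

    push-⊆E : ∀ {e} → e ∈ push L′ → E G (proj₁ e) (proj₂ e)
    push-⊆E e∈ with push-image e∈
    ... | (x , y) , xy∈ , refl = to (adj x y) (All.lookup L′⊆E xy∈)

    push-undeleted : ∀ {u v} → (u , v) ∈ push L′ → Undeleted u × Undeleted v
    push-undeleted uv∈ with push-image uv∈
    ... | (x , y) , _ , refl = ι-undeleted x , ι-undeleted y

    noUndeletedPaw : ∀ a b c d → Undeleted a → Undeleted b → Undeleted c → Undeleted d →
                     ¬ IsPawR (DelE G (push L′)) a b c d
    noUndeletedPaw a b c d ¬Del-a ¬Del-b ¬Del-c ¬Del-d
      with to (image a) ¬Del-a | to (image b) ¬Del-b | to (image c) ¬Del-c | to (image d) ¬Del-d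
    ... | xa , refl | xb , refl | xc , refl | xd , refl =
      pawFree xa xb xc xd ∘ from (IsPawR-embedding {R = DelE G (push L′)} ι (DelE-embedding (push L′) L′ ∈-push))

lemma22 : ∀ {n} (G : Graph n) (k : ℕ) (F : List (Quad n)) →
          MaximalEdgeDisjointPawFamily G F →
          (C : Fin n → Set) → IsComponent G (PawVertices F) C →
          (p : ℕ) (part : Fin n → Fin p) → CompleteMultipartition G C p part →
          (K : Fin p → Bool) → KeptFullParts G C part k K →
          ∀ {m} (Gs : Graph m) (ι : Fin m → Fin n) →
          InducedSubgraphOn G (λ v → ¬ Deleted G C part K v) Gs ι →
          YesInstance G k ⇔ YesInstance Gs k
lemma22 G k _ _ C _ p part cm K kept Gs ι ind =
  mk⇔ (Embedding.YesInstance-restrict G Gs ι injective adj)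
      (FullParts.YesInstance-extend G k C part cm K kept Gs ι ind)
  where open InducedSubgraphOn ind
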